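{- Let $\mathbb{F}$ be a field of characteristic zero and let $\psi$ be the $\mathbb{F}$-linear functional on $\mathbb{F}[\alpha_1,\alpha_2]$ defined on monomials by $\psi(\alpha_1^{2m}\alpha_2^{2n})=\Omega(m,n)1_{\mathbb{F}}$ for $m,n\in\mathbb{N}$ and $\psi(\alpha_1^k\alpha_2^l)=0$ if $k$ or $l$ is odd. Then for every $h\in SO(2,\mathbb{F})$: $\psi(h\cdot\alpha_1^{2m})=\psi(\alpha_1^{2m})$ for all $m\in\mathbb{N}$, and $\psi(h\cdot\alpha_1^{2m-1}\alpha_2)=\psi(\alpha_1^{2m-1}\alpha_2)$ for all integers $m\geq 1$.
   Context: $\mathbb{N}$ includes $0$. $\Omega(m,n)=\dfrac{(2m)!(2n)!}{4^{m+n}\,m!\,n!\,(m+n)!}$, and $a1_{\mathbb{F}}$ is the image of $a\in\mathbb{Q}$ in $\mathbb{F}$. $SO(2,\mathbb{F})$ is the group of $2\times2$ matrices $h$ over $\mathbb{F}$ with $h^{ -1}=h^T$ and $\det h=1$; it acts on $\mathbb{F}[\alpha_1,\alpha_2]$ by $h\cdot\pi(\alpha_1,\alpha_2)=\pi(h_{11}\alpha_1+h_{21}\alpha_2,\,h_{12}\alpha_1+h_{22}\alpha_2)$. -}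

module Defs where

open import Level using (Level; _⊔_) renaming (suc to lsuc)
open import Algebra.Bundles using (CommutativeRing)
open import Data.Nat using (ℕ; zero; suc; NonZero; _!)
import Data.Nat as N
open import Data.Nat.Properties using (m*n≢0; m^n≢0; _!≢0)
open import Data.Integer using (ℤ; +_; -[1+_])
open import Data.Rational using (ℚ; _/_; ↥_; ↧ₙ_)
open import Data.List using (List; []; _∷_; _++_; map; concatMap; foldr)
open import Data.Product using (_×_; _,_)
open import Data.Maybe using (Maybe; just; nothing)
open import Relation.Nullary using (¬_)

record Field (c ℓ : Level) : Set (lsuc (c ⊔ ℓ)) where
  field
    commutativeRing : CommutativeRing c ℓ
  open CommutativeRing commutativeRing public
  field
    _⁻¹       : Carrier → Carrier
    ⁻¹-cong   : ∀ {x y} → x ≈ y → x ⁻¹ ≈ y ⁻¹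
    0≉1       : ¬ (0# ≈ 1#)
    inverseʳ  : ∀ x → ¬ (x ≈ 0#) → x * (x ⁻¹) ≈ 1#

module FieldOps {c ℓ} (F : Field c ℓ) where
  open Field F hiding (zero)

  ℕ→F : ℕ → Carrier
  ℕ→F zero    = 0#
  ℕ→F (suc n) = 1# + ℕ→F n

  ℤ→F : ℤ → Carrier
  ℤ→F (+ n)      = ℕ→F n
  ℤ→F -[1+ n ]   = - ℕ→F (suc n)

  CharZero : Set ℓ
  CharZero = ∀ n → ¬ (ℕ→F (suc n) ≈ 0#)

  -- a 1_F : the image of a rational number a in F (meaningful in char 0)
  ℚ→F : ℚ → Carrier
  ℚ→F q = ℤ→F (↥ q) * (ℕ→F (↧ₙ q) ⁻¹)

  -- polynomials in F[α₁,α₂], represented as formal finite sums of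
  -- terms  c · α₁^k α₂^l  (a term is (c , k , l))
  Poly : Set c
  Poly = List (Carrier × ℕ × ℕ)

  mono : ℕ → ℕ → Poly
  mono k l = (1# , k , l) ∷ []

  _⊕_ : Poly → Poly → Poly
  _⊕_ = _++_

  _⊗_ : Poly → Poly → Poly
  p ⊗ q = concatMap (λ { (a , k , l) → map (λ { (b , k' , l') → (a * b , k N.+ k' , l N.+ l') }) q }) p

  scale : Carrier → Poly → Poly
  scale a = map (λ { (b , k , l) → (a * b , k , l) })

  pow : Poly → ℕ → Poly
  pow p zero    = mono 0 0
  pow p (suc n) = p ⊗ pow p n

  subst₂ : Poly → Poly → Poly → Poly
  subst₂ p u v = foldr (λ { (a , k , l) r → scale a (pow u k ⊗ pow v l) ⊕ r }) [] p

  record SO2 : Set (c ⊔ ℓ) where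
    field
      h11 h12 h21 h22 : Carrier
      hhᵀ-11 : h11 * h11 + h12 * h12 ≈ 1#
      hhᵀ-12 : h11 * h21 + h12 * h22 ≈ 0#
      hhᵀ-21 : h21 * h11 + h22 * h12 ≈ 0#
      hhᵀ-22 : h21 * h21 + h22 * h22 ≈ 1#
      hᵀh-11 : h11 * h11 + h21 * h21 ≈ 1#
      hᵀh-12 : h11 * h12 + h21 * h22 ≈ 0#
      hᵀh-21 : h12 * h11 + h22 * h21 ≈ 0#
      hᵀh-22 : h12 * h12 + h22 * h22 ≈ 1#
      det≈1  : h11 * h22 - h12 * h21 ≈ 1#

  act : SO2 → Poly → Poly
  act h p = subst₂ p ((h11 , 1 , 0) ∷ (h21 , 0 , 1) ∷ [])
                     ((h12 , 1 , 0) ∷ (h22 , 0 , 1) ∷ [])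
    where open SO2 h

  Ω : ℕ → ℕ → ℚ
  Ω m n = (+ ((2 N.* m) ! N.* (2 N.* n) !)) / (4 N.^ (m N.+ n) N.* m ! N.* n ! N.* (m N.+ n) !)
    where
    instance
      i1 : NonZero (4 N.^ (m N.+ n))
      i1 = m^n≢0 4 (m N.+ n)
      i2 : NonZero (m !)
      i2 = m !≢0
      i3 : NonZero (n !)
      i3 = n !≢0
      i4 : NonZero ((m N.+ n) !)
      i4 = (m N.+ n) !≢0
      i5 : NonZero (4 N.^ (m N.+ n) N.* m !)
      i5 = m*n≢0 (4 N.^ (m N.+ n)) (m !)
      i6 : NonZero (4 N.^ (m N.+ n) N.* m ! N.* n !)
      i6 = m*n≢0 (4 N.^ (m N.+ n) N.* m !) (n !)
      i7 : NonZero (4 N.^ (m N.+ n) N.* m ! N.* n ! N.* (m N.+ n) !)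
      i7 = m*n≢0 (4 N.^ (m N.+ n) N.* m ! N.* n !) ((m N.+ n) !)

  half : ℕ → Maybe ℕ
  half zero          = just zero
  half (suc zero)    = nothing
  half (suc (suc k)) with half k
  ... | just j  = just (suc j)
  ... | nothing = nothing

  ψmono : ℕ → ℕ → Carrier
  ψmono k l with half k | half l
  ... | just m  | just n  = ℚ→F (Ω m n)
  ... | _       | _       = 0#

  ψ : Poly → Carrier
  ψ = foldr (λ { (a , k , l) r → a * ψmono k l + r }) 0#

{-# OPTIONS --safe #-}

-- Expanding (x α₁ + y α₂)^N by the binomial theorem, ψ only sees the terms
-- with even exponents, and the factorial identity
--   C(2i+2j, 2i) Ω(i,j) = Ω(i+j,0) C(i+j, i)
-- (with two odd variants) collapses what is left into a second binomial sum:
--   ψ((x α₁ + y α₂)^(2m))               = Ω(m,0) (x² + y²)^m,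
--   ψ((x α₁ + y α₂)^(2n+1) (u α₁ + v α₂)) = Ω(n+1,0) (x u + y v) (x² + y²)^n.
-- For h ∈ SO(2) the first column of h has norm 1 and is orthogonal to the
-- second, so these become Ω(m,0) = ψ(α₁^(2m)) and 0 = ψ(α₁^(2n+1) α₂).

module Submission where

open import Defs
open import Data.Nat as ℕ using (ℕ; zero; suc; _!; NonZero)
open import Data.Product using (_×_; _,_)
open import Data.List using ([]; _∷_; _++_; map)
open import Data.Maybe using (just; nothing)
import Data.Integer as ℤ
import Data.Integer.Properties as ℤ
open import Data.Rational using (mkℚ; _/_; ↥_; ↧_)
open import Data.Rational.Properties using (↥-/; ↧-/)
import Data.Nat.Properties as ℕ
open import Relation.Nullary using (¬_; contradiction)
open import Relation.Binary.PropositionalEquality as ≡ using (_≡_)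

module _ where
  open import Data.Nat using (_+_; _*_; _^_)
  open ≡ using (refl; sym; trans; cong; cong₂)
  open import Data.Nat.Properties
    using (+-identityʳ; *-identityˡ; *-identityʳ; +-suc; +-comm; *-comm; *-distribʳ-+; m*n≢0; m^n≢0; _!≢0)
  open import Data.Nat.Tactic.RingSolver using (solve-∀; solve)
  open ≡.≡-Reasoning

  double : ℕ → ℕ
  double zero    = zero
  double (suc n) = suc (suc (double n))

  double≡2* : ∀ n → double n ≡ 2 * n
  double≡2* zero    = refl
  double≡2* (suc n) = cong suc (trans (cong suc (double≡2* n)) (sym (+-suc n (n + 0))))

  double≡+ : ∀ n → double n ≡ n + n
  double≡+ n = trans (double≡2* n) (cong (n +_) (+-identityʳ n))

  double-+ : ∀ m n → double (m + n) ≡ double m + double n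
  double-+ zero    n = refl
  double-+ (suc m) n = cong (λ k → suc (suc k)) (double-+ m n)

  -- binom k l is the binomial coefficient C(k + l, k); indexing it by the two
  -- parts turns Pascal's rule into its defining equation.
  binom : ℕ → ℕ → ℕ
  binom zero    l       = 1
  binom (suc k) zero    = 1
  binom (suc k) (suc l) = binom k (suc l) + binom (suc k) l

  binom-zeroʳ : ∀ k → binom k 0 ≡ 1
  binom-zeroʳ zero    = refl
  binom-zeroʳ (suc k) = refl

  binom-comm : ∀ k l → binom k l ≡ binom l k
  binom-comm zero    l       = sym (binom-zeroʳ l)
  binom-comm (suc k) zero    = refl
  binom-comm (suc k) (suc l) =
    trans (cong₂ _+_ (binom-comm k (suc l)) (binom-comm (suc k) l)) (+-comm (binom (suc l) k) (binom l (suc k)))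

  -- The two summands of Pascal's rule, a summand being 0 where its index
  -- would be negative.
  binomˡ binomʳ : ℕ → ℕ → ℕ
  binomˡ zero    l       = 0
  binomˡ (suc k) l       = binom k l
  binomʳ k       zero    = 0
  binomʳ k       (suc l) = binom k l

  binom-pascal : ∀ {n} k l → k + l ≡ suc n → binom k l ≡ binomˡ k l + binomʳ k l
  binom-pascal zero    zero    ()
  binom-pascal zero    (suc l) _ = refl
  binom-pascal (suc k) zero    _ = sym (trans (+-identityʳ (binom k 0)) (binom-zeroʳ k))
  binom-pascal (suc k) (suc l) _ = refl

  binom-*-!-! : ∀ k l → binom k l * k ! * l ! ≡ (k + l) !
  binom-*-!-! zero    l       = +-identityʳ (l !)
  binom-*-!-! (suc k) zero    =
    trans (*-identityʳ _) (trans (*-identityˡ _) (cong _! (sym (+-identityʳ (suc k)))))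
  binom-*-!-! (suc k) (suc l) = begin
    (binom k (suc l) + binom (suc k) l) * suc k ! * suc l !
      ≡⟨ regroup (suc k) (suc l) (binom k (suc l)) (binom (suc k) l) (k !) (l !) ⟩
    suc k * (binom k (suc l) * k ! * suc l !) + suc l * (binom (suc k) l * suc k ! * l !)
      ≡⟨ cong₂ (λ u v → suc k * u + suc l * v)
               (trans (binom-*-!-! k (suc l)) (cong _! (+-suc k l))) (binom-*-!-! (suc k) l) ⟩
    suc k * suc (k + l) ! + suc l * suc (k + l) !
      ≡⟨ sym (*-distribʳ-+ (suc (k + l) !) (suc k) (suc l)) ⟩
    (suc k + suc l) * suc (k + l) !
      ≡⟨ cong (λ n → suc n * suc (k + l) !) (+-suc k l) ⟩
    suc (suc (k + l)) !
      ≡⟨ cong (λ n → suc n !) (sym (+-suc k l)) ⟩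
    (suc k + suc l) ! ∎
    where
    regroup : ∀ a b A B x y → (A + B) * (a * x) * (b * y) ≡ a * (A * x * (b * y)) + b * (B * (a * x) * y)
    regroup = solve-∀

  *-cross-common-factor : ∀ n s g {a d} → n * g ≡ a → s * g ≡ d → n * d ≡ a * s
  *-cross-common-factor n s g refl refl = solve (n ∷ s ∷ g ∷ [])

  -- Numerator and denominator of Ω as written in its definition, so that Ω m n is
  -- (+ Ω-num m n) / Ω-den m n by definition.
  Ω-num Ω-den : ℕ → ℕ → ℕ
  Ω-num m n = (2 * m) ! * (2 * n) !
  Ω-den m n = 4 ^ (m + n) * m ! * n ! * (m + n) !

  Ω-den-nonZero : ∀ m n → NonZero (Ω-den m n)
  Ω-den-nonZero m n =
    m*n≢0 _ _ {{m*n≢0 _ _ {{m*n≢0 _ _ {{m^n≢0 4 (m + n)}} {{m !≢0}}}} {{n !≢0}}}} {{(m + n) !≢0}}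

  Ω-num-double : ∀ m n → Ω-num m n ≡ double m ! * double n !
  Ω-num-double m n = cong₂ (λ a b → a ! * b !) (sym (double≡2* m)) (sym (double≡2* n))

  Ω-den-zeroʳ : ∀ m → Ω-den m 0 ≡ 4 ^ m * m ! * 1 * m !
  Ω-den-zeroʳ m = cong (λ n → 4 ^ n * m ! * 1 * n !) (+-identityʳ m)

  Ω-den-comm : ∀ m n → Ω-den m n ≡ Ω-den n m
  Ω-den-comm m n = trans (swap (4 ^ (m + n)) (m !) (n !) ((m + n) !)) (cong (λ k → 4 ^ k * n ! * m ! * k !) (+-comm m n))
    where
    swap : ∀ p a b c → p * a * b * c ≡ p * b * a * c
    swap = solve-∀

  -- The identities below are C(2i+2j, 2i) Ω(i,j) = Ω(i+j,0) C(i+j,i) and its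
  -- odd variants, with denominators cleared.  Once every factorial of a sum is
  -- expanded by binom-*-!-! they are polynomial identities.
  binom-Ω-even : ∀ i j →
    binom (double i) (double j) * Ω-num i j * Ω-den (i + j) 0 ≡ Ω-num (i + j) 0 * binom i j * Ω-den i j
  binom-Ω-even i j = begin
    B * Ω-num i j * Ω-den (i + j) 0
      ≡⟨ cong₂ (λ u v → B * u * v) (Ω-num-double i j) (Ω-den-zeroʳ (i + j)) ⟩
    B * (double i ! * double j !) * (4 ^ (i + j) * (i + j) ! * 1 * (i + j) !)
      ≡⟨ clear B (binom i j) (double i !) (double j !) (i !) (j !) (4 ^ (i + j))
               (binom-*-!-! (double i) (double j)) (binom-*-!-! i j) ⟩
    (double i + double j) ! * 1 * binom i j * Ω-den i j
      ≡⟨ cong (λ n → n ! * 1 * binom i j * Ω-den i j) (sym (double-+ i j)) ⟩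
    double (i + j) ! * 1 * binom i j * Ω-den i j
      ≡⟨ cong (λ a → a * binom i j * Ω-den i j) (sym (Ω-num-double (i + j) 0)) ⟩
    Ω-num (i + j) 0 * binom i j * Ω-den i j ∎
    where
    B = binom (double i) (double j)
    clear : ∀ B b Fx Fy Fi Fj P {G N} → B * Fx * Fy ≡ G → b * Fi * Fj ≡ N →
      B * (Fx * Fy) * (P * N * 1 * N) ≡ G * 1 * b * (P * Fi * Fj * N)
    clear B b Fx Fy Fi Fj P refl refl = solve (B ∷ b ∷ Fx ∷ Fy ∷ Fi ∷ Fj ∷ P ∷ [])

  binom-Ω-oddˡ : ∀ i j → binom (suc (double i)) (double j) * Ω-num (suc i) j * Ω-den (suc (i + j)) 0
                         ≡ Ω-num (suc (i + j)) 0 * binom i j * Ω-den (suc i) j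
  binom-Ω-oddˡ i j = begin
    B * Ω-num (suc i) j * Ω-den (suc (i + j)) 0
      ≡⟨ cong₂ (λ u v → B * u * v) (Ω-num-double (suc i) j) (Ω-den-zeroʳ (suc (i + j))) ⟩
    B * (double (suc i) ! * double j !) * (4 ^ suc (i + j) * suc (i + j) ! * 1 * suc (i + j) !)
      ≡⟨ clear i j B (binom i j) (double i !) (double j !) (i !) (j !) (4 ^ suc (i + j))
               (double≡+ i) (double≡+ j) (double-+ i j)
               (trans (binom-*-!-! (suc (double i)) (double j)) (cong (λ n → suc n !) (sym (double-+ i j))))
               (binom-*-!-! i j) ⟩
    double (suc (i + j)) ! * 1 * binom i j * Ω-den (suc i) j
      ≡⟨ cong (λ a → a * binom i j * Ω-den (suc i) j) (sym (Ω-num-double (suc (i + j)) 0)) ⟩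
    Ω-num (suc (i + j)) 0 * binom i j * Ω-den (suc i) j ∎
    where
    B = binom (suc (double i)) (double j)
    clear : ∀ i j B b Fx Fy Fi Fj P {x y z G N} →
      x ≡ i + i → y ≡ j + j → z ≡ x + y → B * (suc x * Fx) * Fy ≡ G → b * Fi * Fj ≡ N →
      B * (suc (suc x) * (suc x * Fx) * Fy) * (P * (suc (i + j) * N) * 1 * (suc (i + j) * N))
        ≡ suc (suc z) * G * 1 * b * (P * (suc i * Fi) * Fj * (suc (i + j) * N))
    clear i j B b Fx Fy Fi Fj P refl refl refl refl refl = solve (i ∷ j ∷ B ∷ b ∷ Fx ∷ Fy ∷ Fi ∷ Fj ∷ P ∷ [])

  binom-Ω-oddʳ : ∀ i j → binom (double i) (suc (double j)) * Ω-num i (suc j) * Ω-den (suc (i + j)) 0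
                         ≡ Ω-num (suc (i + j)) 0 * binom i j * Ω-den i (suc j)
  binom-Ω-oddʳ i j = begin
    binom (double i) (suc (double j)) * Ω-num i (suc j) * Ω-den (suc (i + j)) 0
      ≡⟨ cong₂ _*_ (cong₂ _*_ (binom-comm (double i) (suc (double j))) (*-comm ((2 * i) !) ((2 * suc j) !)))
                   (cong (λ n → Ω-den (suc n) 0) (+-comm i j)) ⟩
    binom (suc (double j)) (double i) * Ω-num (suc j) i * Ω-den (suc (j + i)) 0
      ≡⟨ binom-Ω-oddˡ j i ⟩
    Ω-num (suc (j + i)) 0 * binom j i * Ω-den (suc j) i
      ≡⟨ cong₂ _*_ (cong₂ _*_ (cong (λ n → Ω-num (suc n) 0) (+-comm j i)) (binom-comm j i)) (Ω-den-comm (suc j) i) ⟩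
    Ω-num (suc (i + j)) 0 * binom i j * Ω-den i (suc j) ∎

module _ {c ℓ} (F : Field c ℓ) where
  open Field F hiding (zero)
  open FieldOps F
  open import Algebra.Properties.Semiring.Exp semiring using (_^_; ^-congˡ)
  open import Algebra.Properties.Semiring.Mult semiring using (×-homo-+; ×1-homo-*) renaming (_×_ to _·_)
  open import Algebra.Solver.Ring.NaturalCoefficients.Default commutativeSemiring
    using (solve; _:=_; _:+_; _:*_; con)
  open import Relation.Binary.Reasoning.Setoid setoid

  ℕ→F≈·1# : ∀ n → ℕ→F n ≈ n · 1#
  ℕ→F≈·1# zero    = refl
  ℕ→F≈·1# (suc n) = +-cong refl (ℕ→F≈·1# n)

  ℕ→F-+ : ∀ m n → ℕ→F (m ℕ.+ n) ≈ ℕ→F m + ℕ→F n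
  ℕ→F-+ m n = begin
    ℕ→F (m ℕ.+ n)   ≈⟨ ℕ→F≈·1# (m ℕ.+ n) ⟩
    (m ℕ.+ n) · 1#  ≈⟨ ×-homo-+ 1# m n ⟩
    m · 1# + n · 1# ≈⟨ +-cong (ℕ→F≈·1# m) (ℕ→F≈·1# n) ⟨
    ℕ→F m + ℕ→F n   ∎

  ℕ→F-* : ∀ m n → ℕ→F (m ℕ.* n) ≈ ℕ→F m * ℕ→F n
  ℕ→F-* m n = begin
    ℕ→F (m ℕ.* n)     ≈⟨ ℕ→F≈·1# (m ℕ.* n) ⟩
    (m ℕ.* n) · 1#    ≈⟨ ×1-homo-* m n ⟩
    m · 1# * (n · 1#) ≈⟨ *-cong (ℕ→F≈·1# m) (ℕ→F≈·1# n) ⟨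
    ℕ→F m * ℕ→F n     ∎

  ^-double : ∀ x i → x ^ double i ≈ (x * x) ^ i
  ^-double x zero    = refl
  ^-double x (suc i) = trans (sym (*-assoc x x _)) (*-cong refl (^-double x i))

  1^n≈1 : ∀ n → 1# ^ n ≈ 1#
  1^n≈1 zero    = refl
  1^n≈1 (suc n) = trans (*-identityˡ _) (1^n≈1 n)

  cross-multiplication : ∀ {a b d₁ d₂} → ¬ d₁ ≈ 0# → ¬ d₂ ≈ 0# →
    a * d₂ ≈ b * d₁ → a * d₁ ⁻¹ ≈ b * d₂ ⁻¹
  cross-multiplication {a} {b} {d₁} {d₂} d₁≉0 d₂≉0 ad₂≈bd₁ = begin
    a * d₁ ⁻¹
      ≈⟨ trans (*-cong refl (inverseʳ d₂ d₂≉0)) (*-identityʳ _) ⟨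
    a * d₁ ⁻¹ * (d₂ * d₂ ⁻¹)
      ≈⟨ solve 4 (λ a e d f → a :* e :* (d :* f) := a :* d :* (e :* f)) refl a (d₁ ⁻¹) d₂ (d₂ ⁻¹) ⟩
    a * d₂ * (d₁ ⁻¹ * d₂ ⁻¹)
      ≈⟨ *-cong ad₂≈bd₁ refl ⟩
    b * d₁ * (d₁ ⁻¹ * d₂ ⁻¹)
      ≈⟨ solve 4 (λ b d e f → b :* d :* (e :* f) := b :* f :* (d :* e)) refl b d₁ (d₁ ⁻¹) (d₂ ⁻¹) ⟩
    b * d₂ ⁻¹ * (d₁ * d₁ ⁻¹)
      ≈⟨ trans (*-cong refl (inverseʳ d₁ d₁≉0)) (*-identityʳ _) ⟩
    b * d₂ ⁻¹ ∎

  -- ψ is lin ψmono; general weights are needed because in a product p ⊗ q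
  -- the factor p sees the weights shifted by the monomials of q (lin-⊗).
  lin : (ℕ → ℕ → Carrier) → Poly → Carrier
  lin φ []                = 0#
  lin φ ((a , k , l) ∷ p) = a * φ k l + lin φ p

  shift : (ℕ → ℕ → Carrier) → ℕ → ℕ → ℕ → ℕ → Carrier
  shift φ k l k′ l′ = φ (k ℕ.+ k′) (l ℕ.+ l′)

  ψ≈lin : ∀ p → ψ p ≈ lin ψmono p
  ψ≈lin []                = refl
  ψ≈lin ((a , k , l) ∷ p) = +-cong refl (ψ≈lin p)

  lin-cong : ∀ {φ φ′} → (∀ k l → φ k l ≈ φ′ k l) → ∀ p → lin φ p ≈ lin φ′ p
  lin-cong φ≈φ′ []                = refl
  lin-cong φ≈φ′ ((a , k , l) ∷ p) = +-cong (*-cong refl (φ≈φ′ k l)) (lin-cong φ≈φ′ p)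

  lin-++ : ∀ φ p q → lin φ (p ++ q) ≈ lin φ p + lin φ q
  lin-++ φ []                q = sym (+-identityˡ _)
  lin-++ φ ((a , k , l) ∷ p) q = trans (+-cong refl (lin-++ φ p q)) (sym (+-assoc _ _ _))

  lin-map-shift : ∀ φ a k l (f : Carrier × ℕ × ℕ → Carrier × ℕ × ℕ) →
    (∀ b k′ l′ → f (b , k′ , l′) ≡ (a * b , k ℕ.+ k′ , l ℕ.+ l′)) →
    ∀ q → lin φ (map f q) ≈ a * lin (shift φ k l) q
  lin-map-shift φ a k l f f≡ []                   = sym (zeroʳ a)
  lin-map-shift φ a k l f f≡ ((b , k′ , l′) ∷ q) rewrite f≡ b k′ l′ = begin
    a * b * shift φ k l k′ l′ + lin φ (map f q)
      ≈⟨ +-cong refl (lin-map-shift φ a k l f f≡ q) ⟩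
    a * b * shift φ k l k′ l′ + a * lin (shift φ k l) q
      ≈⟨ solve 4 (λ a b x y → a :* b :* x :+ a :* y := a :* (b :* x :+ y)) refl a b _ _ ⟩
    a * (b * shift φ k l k′ l′ + lin (shift φ k l) q) ∎

  lin-⊗ : ∀ φ p q → lin φ (p ⊗ q) ≈ lin (λ k l → lin (shift φ k l) q) p
  lin-⊗ φ []                q = refl
  lin-⊗ φ ((a , k , l) ∷ p) q =
    trans (lin-++ φ (map _ q) (p ⊗ q)) (+-cong (lin-map-shift φ a k l _ (λ _ _ _ → ≡.refl) q) (lin-⊗ φ p q))

  lin-⊗-congʳ : ∀ {q q′} → (∀ φ → lin φ q ≈ lin φ q′) → ∀ φ p → lin φ (p ⊗ q) ≈ lin φ (p ⊗ q′)
  lin-⊗-congʳ {q} {q′} q≈q′ φ p = begin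
    lin φ (p ⊗ q)                            ≈⟨ lin-⊗ φ p q ⟩
    lin (λ k l → lin (shift φ k l) q) p      ≈⟨ lin-cong (λ k l → q≈q′ (shift φ k l)) p ⟩
    lin (λ k l → lin (shift φ k l) q′) p     ≈⟨ lin-⊗ φ p q′ ⟨
    lin φ (p ⊗ q′)                           ∎

  lin-⊗-unitʳ : ∀ φ p → lin φ (p ⊗ mono 0 0) ≈ lin φ p
  lin-⊗-unitʳ φ p = trans (lin-⊗ φ p (mono 0 0)) (lin-cong unit p)
    where
    unit : ∀ k l → 1# * shift φ k l 0 0 + 0# ≈ φ k l
    unit k l = trans (+-identityʳ _) (trans (*-identityˡ _)
                 (reflexive (≡.cong₂ φ (ℕ.+-identityʳ k) (ℕ.+-identityʳ l))))

  linear : Carrier → Carrier → Poly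
  linear x y = (x , 1 , 0) ∷ (y , 0 , 1) ∷ []

  lin-⊗-linear : ∀ φ u v p → lin φ (p ⊗ linear u v) ≈ lin (λ k l → u * φ (suc k) l + v * φ k (suc l)) p
  lin-⊗-linear φ u v p = trans (lin-⊗ φ p (linear u v)) (lin-cong shifted p)
    where
    shifted : ∀ k l → u * shift φ k l 1 0 + (v * shift φ k l 0 1 + 0#) ≈ u * φ (suc k) l + v * φ k (suc l)
    shifted k l = +-cong (*-cong refl (reflexive (≡.cong₂ φ (ℕ.+-comm k 1) (ℕ.+-identityʳ l))))
                         (trans (+-identityʳ _) (*-cong refl (reflexive (≡.cong₂ φ (ℕ.+-identityʳ k) (ℕ.+-comm l 1)))))

  lin-act-mono : ∀ h φ N M → lin φ (act h (mono N M))
    ≈ lin φ (pow (linear (SO2.h11 h) (SO2.h21 h)) N ⊗ pow (linear (SO2.h12 h) (SO2.h22 h)) M)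
  lin-act-mono h φ N M = begin
    lin φ (scale 1# P ++ [])  ≈⟨ trans (lin-++ φ (scale 1# P) []) (+-identityʳ _) ⟩
    lin φ (scale 1# P)        ≈⟨ lin-map-shift φ 1# 0 0 _ (λ _ _ _ → ≡.refl) P ⟩
    1# * lin φ P              ≈⟨ *-identityˡ _ ⟩
    lin φ P                   ∎
    where
    P = pow (linear (SO2.h11 h) (SO2.h21 h)) N ⊗ pow (linear (SO2.h12 h) (SO2.h22 h)) M

  -- ∑ n g is the sum of g k l over the pairs (k , l) with k + l = n.
  ∑ : ℕ → (ℕ → ℕ → Carrier) → Carrier
  ∑ zero    g = g 0 0
  ∑ (suc n) g = g 0 (suc n) + ∑ n (λ k l → g (suc k) l)

  ∑-cong : ∀ n {g g′} → (∀ k l → k ℕ.+ l ≡ n → g k l ≈ g′ k l) → ∑ n g ≈ ∑ n g′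
  ∑-cong zero    g≈g′ = g≈g′ 0 0 ≡.refl
  ∑-cong (suc n) g≈g′ = +-cong (g≈g′ 0 (suc n) ≡.refl) (∑-cong n (λ k l eq → g≈g′ (suc k) l (≡.cong suc eq)))

  ∑-+ : ∀ n g g′ → ∑ n (λ k l → g k l + g′ k l) ≈ ∑ n g + ∑ n g′
  ∑-+ zero    g g′ = refl
  ∑-+ (suc n) g g′ = trans (+-cong refl (∑-+ n _ _))
    (solve 4 (λ a b c d → (a :+ b) :+ (c :+ d) := (a :+ c) :+ (b :+ d)) refl _ _ _ _)

  ∑-*ˡ : ∀ n a g → ∑ n (λ k l → a * g k l) ≈ a * ∑ n g
  ∑-*ˡ zero    a g = refl
  ∑-*ˡ (suc n) a g = trans (+-cong refl (∑-*ˡ n a _)) (sym (distribˡ a _ _))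

  ∑-zero : ∀ n → ∑ n (λ _ _ → 0#) ≈ 0#
  ∑-zero zero    = refl
  ∑-zero (suc n) = trans (+-cong refl (∑-zero n)) (+-identityˡ _)

  ∑-last : ∀ n g → ∑ (suc n) g ≈ ∑ n (λ k l → g k (suc l)) + g (suc n) 0
  ∑-last zero    g = refl
  ∑-last (suc n) g = trans (+-cong refl (∑-last n (λ k l → g (suc k) l))) (sym (+-assoc _ _ _))

  ∑-pascal : ∀ n (m : ℕ → ℕ → Carrier) →
    ∑ (suc n) (λ k l → ℕ→F (binom k l) * m k l)
      ≈ ∑ n (λ k l → ℕ→F (binom k l) * m (suc k) l) + ∑ n (λ k l → ℕ→F (binom k l) * m k (suc l))
  ∑-pascal n m = begin
    ∑ (suc n) (λ k l → ℕ→F (binom k l) * m k l)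
      ≈⟨ ∑-cong (suc n) split ⟩
    ∑ (suc n) (λ k l → gˡ k l + gʳ k l)
      ≈⟨ ∑-+ (suc n) gˡ gʳ ⟩
    ∑ (suc n) gˡ + ∑ (suc n) gʳ
      ≈⟨ +-cong (trans (+-cong (zeroˡ (m 0 (suc n))) refl) (+-identityˡ _))
                (trans (∑-last n gʳ) (trans (+-cong refl (zeroˡ (m (suc n) 0))) (+-identityʳ _))) ⟩
    ∑ n (λ k l → ℕ→F (binom k l) * m (suc k) l) + ∑ n (λ k l → ℕ→F (binom k l) * m k (suc l)) ∎
    where
    gˡ gʳ : ℕ → ℕ → Carrier
    gˡ k l = ℕ→F (binomˡ k l) * m k l
    gʳ k l = ℕ→F (binomʳ k l) * m k l
    split : ∀ k l → k ℕ.+ l ≡ suc n → ℕ→F (binom k l) * m k l ≈ gˡ k l + gʳ k l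
    split k l eq = trans (*-cong pascal refl) (distribʳ (m k l) _ _)
      where pascal = trans (reflexive (≡.cong ℕ→F (binom-pascal k l eq))) (ℕ→F-+ (binomˡ k l) (binomʳ k l))

  binomial-theorem : ∀ x y n → ∑ n (λ k l → ℕ→F (binom k l) * (x ^ k * y ^ l)) ≈ (x + y) ^ n
  binomial-theorem x y zero    = solve 0 ((con 1 :+ con 0) :* (con 1 :* con 1) := con 1) refl
  binomial-theorem x y (suc n) = begin
    ∑ (suc n) (λ k l → ℕ→F (binom k l) * (x ^ k * y ^ l))
      ≈⟨ ∑-pascal n (λ k l → x ^ k * y ^ l) ⟩
    ∑ n (λ k l → ℕ→F (binom k l) * (x ^ suc k * y ^ l)) + ∑ n (λ k l → ℕ→F (binom k l) * (x ^ k * y ^ suc l))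
      ≈⟨ +-cong (trans (∑-cong n (λ _ _ _ → pullˡ)) (∑-*ˡ n x _))
                (trans (∑-cong n (λ _ _ _ → pullʳ)) (∑-*ˡ n y _)) ⟩
    x * S + y * S
      ≈⟨ +-cong (*-cong refl (binomial-theorem x y n)) (*-cong refl (binomial-theorem x y n)) ⟩
    x * (x + y) ^ n + y * (x + y) ^ n
      ≈⟨ distribʳ _ x y ⟨
    (x + y) ^ suc n ∎
    where
    S = ∑ n (λ k l → ℕ→F (binom k l) * (x ^ k * y ^ l))
    pullˡ : ∀ {b p q} → b * (x * p * q) ≈ x * (b * (p * q))
    pullˡ = solve 4 (λ x b p q → b :* (x :* p :* q) := x :* (b :* (p :* q))) refl x _ _ _
    pullʳ : ∀ {b p q} → b * (p * (y * q)) ≈ y * (b * (p * q))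
    pullʳ = solve 4 (λ y b p q → b :* (p :* (y :* q)) := y :* (b :* (p :* q))) refl y _ _ _

  ∑-binomial : ∀ n x y a g → (∀ i j → i ℕ.+ j ≡ n → g i j ≈ a * (ℕ→F (binom i j) * (x ^ i * y ^ j))) →
    ∑ n g ≈ a * (x + y) ^ n
  ∑-binomial n x y a g g≈ = trans (∑-cong n g≈) (trans (∑-*ˡ n a _) (*-cong refl (binomial-theorem x y n)))

  ∑-oddOdd : ℕ → (ℕ → ℕ → Carrier) → Carrier
  ∑-oddOdd zero    g = 0#
  ∑-oddOdd (suc n) g = ∑ n (λ i j → g (suc (double i)) (suc (double j)))

  ∑-double : ∀ n g → ∑ (double n) g ≈ ∑ n (λ i j → g (double i) (double j)) + ∑-oddOdd n g
  ∑-suc-double : ∀ n g →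
    ∑ (suc (double n)) g ≈ ∑ n (λ i j → g (suc (double i)) (double j)) + ∑ n (λ i j → g (double i) (suc (double j)))

  ∑-double zero    g = sym (+-identityʳ _)
  ∑-double (suc n) g = trans (+-cong refl (∑-suc-double n (λ k l → g (suc k) l))) (sym (+-assoc _ _ _))

  ∑-suc-double n g = begin
    g 0 (suc (double n)) + ∑ (double n) (λ k l → g (suc k) l)
      ≈⟨ +-cong refl (∑-double n (λ k l → g (suc k) l)) ⟩
    g 0 (suc (double n)) + (∑ n (λ i j → g (suc (double i)) (double j)) + ∑-oddOdd n (λ k l → g (suc k) l))
      ≈⟨ solve 3 (λ a b c → a :+ (b :+ c) := b :+ (a :+ c)) refl _ _ _ ⟩
    ∑ n (λ i j → g (suc (double i)) (double j)) + (g 0 (suc (double n)) + ∑-oddOdd n (λ k l → g (suc k) l))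
      ≈⟨ +-cong refl (evenOdd n) ⟨
    ∑ n (λ i j → g (suc (double i)) (double j)) + ∑ n (λ i j → g (double i) (suc (double j))) ∎
    where
    evenOdd : ∀ n → ∑ n (λ i j → g (double i) (suc (double j)))
                      ≈ g 0 (suc (double n)) + ∑-oddOdd n (λ k l → g (suc k) l)
    evenOdd zero    = sym (+-identityʳ _)
    evenOdd (suc n) = refl

  lin-pow-linear : ∀ x y n φ →
    lin φ (pow (linear x y) n) ≈ ∑ n (λ k l → ℕ→F (binom k l) * (x ^ k * y ^ l * φ k l))
  lin-pow-linear x y zero    φ = solve 1 (λ f → con 1 :* f :+ con 0 := (con 1 :+ con 0) :* (con 1 :* con 1 :* f)) refl (φ 0 0)
  lin-pow-linear x y (suc n) φ = begin
    lin φ (linear x y ⊗ pow (linear x y) n)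
      ≈⟨ lin-⊗ φ (linear x y) (pow (linear x y) n) ⟩
    x * lin (λ k l → φ (suc k) l) (pow (linear x y) n) + (y * lin (λ k l → φ k (suc l)) (pow (linear x y) n) + 0#)
      ≈⟨ +-cong (*-cong refl (lin-pow-linear x y n _))
                (trans (+-identityʳ _) (*-cong refl (lin-pow-linear x y n _))) ⟩
    x * ∑ n (λ k l → ℕ→F (binom k l) * (x ^ k * y ^ l * φ (suc k) l))
      + y * ∑ n (λ k l → ℕ→F (binom k l) * (x ^ k * y ^ l * φ k (suc l)))
      ≈⟨ +-cong (trans (sym (∑-*ˡ n x _)) (∑-cong n (λ _ _ _ → shiftˡ)))
                (trans (sym (∑-*ˡ n y _)) (∑-cong n (λ _ _ _ → shiftʳ))) ⟩
    ∑ n (λ k l → ℕ→F (binom k l) * m (suc k) l) + ∑ n (λ k l → ℕ→F (binom k l) * m k (suc l))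
      ≈⟨ ∑-pascal n m ⟨
    ∑ (suc n) (λ k l → ℕ→F (binom k l) * m k l) ∎
    where
    m : ℕ → ℕ → Carrier
    m k l = x ^ k * y ^ l * φ k l
    shiftˡ : ∀ {b p q f} → x * (b * (p * q * f)) ≈ b * (x * p * q * f)
    shiftˡ = solve 5 (λ x b p q f → x :* (b :* (p :* q :* f)) := b :* (x :* p :* q :* f)) refl x _ _ _ _
    shiftʳ : ∀ {b p q f} → y * (b * (p * q * f)) ≈ b * (p * (y * q) * f)
    shiftʳ = solve 5 (λ y b p q f → y :* (b :* (p :* q :* f)) := b :* (p :* (y :* q) :* f)) refl y _ _ _ _

  ω : ℕ → ℕ → Carrier
  ω m n = ℚ→F (Ω m n)

  half-double : ∀ i → half (double i) ≡ just i
  half-double zero                              = ≡.refl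
  half-double (suc i) rewrite half-double i     = ≡.refl

  half-suc-double : ∀ i → half (suc (double i)) ≡ nothing
  half-suc-double zero                          = ≡.refl
  half-suc-double (suc i) rewrite half-suc-double i = ≡.refl

  ψmono-even : ∀ i j → ψmono (double i) (double j) ≡ ω i j
  ψmono-even i j rewrite half-double i | half-double j = ≡.refl

  ψmono-oddˡ : ∀ i l → ψmono (suc (double i)) l ≡ 0#
  ψmono-oddˡ i l rewrite half-suc-double i = ≡.refl

  ψ-mono : ∀ k l → ψ (mono k l) ≈ ψmono k l
  ψ-mono k l = trans (+-identityʳ _) (*-identityˡ _)

  module _ (char0 : CharZero) where

    ℕ→F-nonZero : ∀ n .{{_ : NonZero n}} → ¬ ℕ→F n ≈ 0#
    ℕ→F-nonZero (suc n) = char0 n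

    ℕ→F-fraction-cong : ∀ n₁ d₁ n₂ d₂ .{{_ : NonZero d₁}} .{{_ : NonZero d₂}} →
      n₁ ℕ.* d₂ ≡ n₂ ℕ.* d₁ → ℕ→F n₁ * ℕ→F d₁ ⁻¹ ≈ ℕ→F n₂ * ℕ→F d₂ ⁻¹
    ℕ→F-fraction-cong n₁ d₁ n₂ d₂ eq = cross-multiplication (ℕ→F-nonZero d₁) (ℕ→F-nonZero d₂)
      (trans (sym (ℕ→F-* n₁ d₂)) (trans (reflexive (≡.cong ℕ→F eq)) (ℕ→F-* n₂ d₁)))

    -- ↥-/ and ↧-/ recover a and d from the reduced numerator and denominator
    -- of (+ a) / d by multiplying back their gcd g.
    ℚ→F-/ : ∀ a d .{{_ : NonZero d}} → ℚ→F ((ℤ.+ a) / d) ≈ ℕ→F a * ℕ→F d ⁻¹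
    ℚ→F-/ a d = reduced ((ℤ.+ a) / d) (↥-/ (ℤ.+ a) d) (↧-/ (ℤ.+ a) d)
      where
      unpos : ∀ m g {k} → ℤ.+ m ℤ.* ℤ.+ g ≡ ℤ.+ k → m ℕ.* g ≡ k
      unpos m g eq = ℤ.+-injective (≡.trans (ℤ.pos-* m g) eq)

      reduced : ∀ q {g} → ↥ q ℤ.* ℤ.+ g ≡ ℤ.+ a → ↧ q ℤ.* ℤ.+ g ≡ ℤ.+ d →
        ℚ→F q ≈ ℕ→F a * ℕ→F d ⁻¹
      reduced (mkℚ (ℤ.+ n) s-1 _) {g} n*g≡a s*g≡d =
        ℕ→F-fraction-cong n (suc s-1) a d
          (*-cross-common-factor n (suc s-1) g (unpos n g n*g≡a) (unpos (suc s-1) g s*g≡d))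
      reduced (mkℚ ℤ.-[1+ _ ] s-1 _) {zero} _ s*0≡d =
        contradiction (≡.trans (≡.sym (unpos (suc s-1) 0 s*0≡d)) (ℕ.*-zeroʳ (suc s-1))) (ℕ.≢-nonZero⁻¹ d)
      reduced (mkℚ ℤ.-[1+ _ ] _ _) {suc _} () _

    ω≈Ω-num/Ω-den : ∀ m n → ω m n ≈ ℕ→F (Ω-num m n) * ℕ→F (Ω-den m n) ⁻¹
    ω≈Ω-num/Ω-den m n = ℚ→F-/ (Ω-num m n) (Ω-den m n) {{Ω-den-nonZero m n}}

    binom-ω : ∀ B b m₁ n₁ m₂ n₂ →
      B ℕ.* Ω-num m₁ n₁ ℕ.* Ω-den m₂ n₂ ≡ Ω-num m₂ n₂ ℕ.* b ℕ.* Ω-den m₁ n₁ →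
      ℕ→F B * ω m₁ n₁ ≈ ω m₂ n₂ * ℕ→F b
    binom-ω B b m₁ n₁ m₂ n₂ eq = begin
      ℕ→F B * ω m₁ n₁
        ≈⟨ *-cong refl (ω≈Ω-num/Ω-den m₁ n₁) ⟩
      ℕ→F B * (ℕ→F N₁ * ℕ→F D₁ ⁻¹)
        ≈⟨ trans (sym (*-assoc _ _ _)) (*-cong (sym (ℕ→F-* B N₁)) refl) ⟩
      ℕ→F (B ℕ.* N₁) * ℕ→F D₁ ⁻¹
        ≈⟨ ℕ→F-fraction-cong (B ℕ.* N₁) D₁ (N₂ ℕ.* b) D₂
             {{Ω-den-nonZero m₁ n₁}} {{Ω-den-nonZero m₂ n₂}} eq ⟩
      ℕ→F (N₂ ℕ.* b) * ℕ→F D₂ ⁻¹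
        ≈⟨ *-cong (ℕ→F-* N₂ b) refl ⟩
      ℕ→F N₂ * ℕ→F b * ℕ→F D₂ ⁻¹
        ≈⟨ solve 3 (λ a b c → a :* b :* c := a :* c :* b) refl _ _ _ ⟩
      ℕ→F N₂ * ℕ→F D₂ ⁻¹ * ℕ→F b
        ≈⟨ *-cong (ω≈Ω-num/Ω-den m₂ n₂) refl ⟨
      ω m₂ n₂ * ℕ→F b ∎
      where
      N₁ = Ω-num m₁ n₁
      D₁ = Ω-den m₁ n₁
      N₂ = Ω-num m₂ n₂
      D₂ = Ω-den m₂ n₂

    ψ-even-power : ∀ x y m → lin ψmono (pow (linear x y) (double m)) ≈ ω m 0 * (x * x + y * y) ^ m
    ψ-even-power x y m = begin
      lin ψmono (pow (linear x y) (double m))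
        ≈⟨ lin-pow-linear x y (double m) ψmono ⟩
      ∑ (double m) t
        ≈⟨ ∑-double m t ⟩
      ∑ m (λ i j → t (double i) (double j)) + ∑-oddOdd m t
        ≈⟨ +-cong (∑-binomial m (x * x) (y * y) (ω m 0) _ even-term) (oddOdd≈0 m) ⟩
      ω m 0 * (x * x + y * y) ^ m + 0#
        ≈⟨ +-identityʳ _ ⟩
      ω m 0 * (x * x + y * y) ^ m ∎
      where
      t : ℕ → ℕ → Carrier
      t k l = ℕ→F (binom k l) * (x ^ k * y ^ l * ψmono k l)

      even-term : ∀ i j → i ℕ.+ j ≡ m →
        t (double i) (double j) ≈ ω m 0 * (ℕ→F (binom i j) * ((x * x) ^ i * (y * y) ^ j))
      even-term i j i+j≡m = begin
        ℕ→F B * (x ^ double i * y ^ double j * ψmono (double i) (double j))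
          ≈⟨ *-cong refl (*-cong (*-cong (^-double x i) (^-double y j)) (reflexive (ψmono-even i j))) ⟩
        ℕ→F B * ((x * x) ^ i * (y * y) ^ j * ω i j)
          ≈⟨ solve 4 (λ b p q w → b :* (p :* q :* w) := b :* w :* (p :* q)) refl _ _ _ _ ⟩
        ℕ→F B * ω i j * ((x * x) ^ i * (y * y) ^ j)
          ≈⟨ *-cong (binom-ω B (binom i j) i j (i ℕ.+ j) 0 (binom-Ω-even i j)) refl ⟩
        ω (i ℕ.+ j) 0 * ℕ→F (binom i j) * ((x * x) ^ i * (y * y) ^ j)
          ≈⟨ trans (*-assoc _ _ _) (*-cong (reflexive (≡.cong (λ n → ω n 0) i+j≡m)) refl) ⟩
        ω m 0 * (ℕ→F (binom i j) * ((x * x) ^ i * (y * y) ^ j)) ∎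
        where B = binom (double i) (double j)

      oddOdd≈0 : ∀ n → ∑-oddOdd n t ≈ 0#
      oddOdd≈0 zero    = refl
      oddOdd≈0 (suc n) = trans (∑-cong n (λ i j _ → vanishes i j)) (∑-zero n)
        where
        vanishes : ∀ i j → t (suc (double i)) (suc (double j)) ≈ 0#
        vanishes i j =
          trans (*-cong refl (trans (*-cong refl (reflexive (ψmono-oddˡ i (suc (double j))))) (zeroʳ _))) (zeroʳ _)

    ψ-odd-power : ∀ x y u v n → lin ψmono (pow (linear x y) (suc (double n)) ⊗ linear u v)
                                  ≈ ω (suc n) 0 * (x * u + y * v) * (x * x + y * y) ^ n
    ψ-odd-power x y u v n = begin
      lin ψmono (pow (linear x y) (suc (double n)) ⊗ linear u v)
        ≈⟨ lin-⊗-linear ψmono u v (pow (linear x y) (suc (double n))) ⟩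
      lin φ (pow (linear x y) (suc (double n)))
        ≈⟨ lin-pow-linear x y (suc (double n)) φ ⟩
      ∑ (suc (double n)) t
        ≈⟨ ∑-suc-double n t ⟩
      ∑ n (λ i j → t (suc (double i)) (double j)) + ∑ n (λ i j → t (double i) (suc (double j)))
        ≈⟨ +-cong (∑-binomial n (x * x) (y * y) (w * (x * u)) _ odd-even-term)
                  (∑-binomial n (x * x) (y * y) (w * (y * v)) _ even-odd-term) ⟩
      w * (x * u) * s + w * (y * v) * s
        ≈⟨ solve 4 (λ w a b s → w :* a :* s :+ w :* b :* s := w :* (a :+ b) :* s) refl w (x * u) (y * v) s ⟩
      w * (x * u + y * v) * s ∎
      where
      w = ω (suc n) 0
      s = (x * x + y * y) ^ n

      φ t : ℕ → ℕ → Carrier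
      φ k l = u * ψmono (suc k) l + v * ψmono k (suc l)
      t k l = ℕ→F (binom k l) * (x ^ k * y ^ l * φ k l)

      φ-odd-even : ∀ i j → φ (suc (double i)) (double j) ≈ u * ω (suc i) j
      φ-odd-even i j = trans (+-cong (*-cong refl (reflexive (ψmono-even (suc i) j)))
                                     (*-cong refl (reflexive (ψmono-oddˡ i (suc (double j))))))
                             (trans (+-cong refl (zeroʳ v)) (+-identityʳ _))

      φ-even-odd : ∀ i j → φ (double i) (suc (double j)) ≈ v * ω i (suc j)
      φ-even-odd i j = trans (+-cong (*-cong refl (reflexive (ψmono-oddˡ i (suc (double j)))))
                                     (*-cong refl (reflexive (ψmono-even i (suc j)))))
                             (trans (+-cong (zeroʳ u) refl) (+-identityˡ _))

      sq : ℕ → ℕ → Carrier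
      sq i j = (x * x) ^ i * (y * y) ^ j

      regroup : ∀ i j → i ℕ.+ j ≡ n → ∀ B o a → ℕ→F B * o ≈ ω (suc (i ℕ.+ j)) 0 * ℕ→F (binom i j) →
        ℕ→F B * o * a * sq i j ≈ w * a * (ℕ→F (binom i j) * sq i j)
      regroup i j i+j≡n B o a Bo≈ = trans (*-cong (*-cong (trans Bo≈ (*-cong ω≈w refl)) refl) refl)
                                          (solve 4 (λ w b a p → w :* b :* a :* p := w :* a :* (b :* p)) refl w _ a _)
        where ω≈w = reflexive (≡.cong (λ k → ω (suc k) 0) i+j≡n)

      odd-even-term : ∀ i j → i ℕ.+ j ≡ n → t (suc (double i)) (double j) ≈ w * (x * u) * (ℕ→F (binom i j) * sq i j)
      odd-even-term i j i+j≡n = begin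
        ℕ→F B * (x * x ^ double i * y ^ double j * φ (suc (double i)) (double j))
          ≈⟨ *-cong refl (*-cong (*-cong (*-cong refl (^-double x i)) (^-double y j)) (φ-odd-even i j)) ⟩
        ℕ→F B * (x * (x * x) ^ i * (y * y) ^ j * (u * ω (suc i) j))
          ≈⟨ solve 6 (λ b x p q u o → b :* (x :* p :* q :* (u :* o)) := b :* o :* (x :* u) :* (p :* q))
                     refl _ x _ _ u _ ⟩
        ℕ→F B * ω (suc i) j * (x * u) * sq i j
          ≈⟨ regroup i j i+j≡n B _ _ (binom-ω B (binom i j) (suc i) j (suc (i ℕ.+ j)) 0 (binom-Ω-oddˡ i j)) ⟩
        w * (x * u) * (ℕ→F (binom i j) * sq i j) ∎
        where B = binom (suc (double i)) (double j)

      even-odd-term : ∀ i j → i ℕ.+ j ≡ n → t (double i) (suc (double j)) ≈ w * (y * v) * (ℕ→F (binom i j) * sq i j)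
      even-odd-term i j i+j≡n = begin
        ℕ→F B * (x ^ double i * (y * y ^ double j) * φ (double i) (suc (double j)))
          ≈⟨ *-cong refl (*-cong (*-cong (^-double x i) (*-cong refl (^-double y j))) (φ-even-odd i j)) ⟩
        ℕ→F B * ((x * x) ^ i * (y * (y * y) ^ j) * (v * ω i (suc j)))
          ≈⟨ solve 6 (λ b p y q v o → b :* (p :* (y :* q) :* (v :* o)) := b :* o :* (y :* v) :* (p :* q))
                     refl _ _ y _ v _ ⟩
        ℕ→F B * ω i (suc j) * (y * v) * sq i j
          ≈⟨ regroup i j i+j≡n B _ _ (binom-ω B (binom i j) i (suc j) (suc (i ℕ.+ j)) 0 (binom-Ω-oddʳ i j)) ⟩
        w * (y * v) * (ℕ→F (binom i j) * sq i j) ∎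
        where B = binom (double i) (suc (double j))

    ψ-act-even : ∀ h m → ψ (act h (mono (double m) 0)) ≈ ψ (mono (double m) 0)
    ψ-act-even h m = begin
      ψ (act h (mono (double m) 0))
        ≈⟨ trans (ψ≈lin (act h (mono (double m) 0))) (lin-act-mono h ψmono (double m) 0) ⟩
      lin ψmono (pow (linear h11 h21) (double m) ⊗ mono 0 0)
        ≈⟨ lin-⊗-unitʳ ψmono (pow (linear h11 h21) (double m)) ⟩
      lin ψmono (pow (linear h11 h21) (double m))
        ≈⟨ ψ-even-power h11 h21 m ⟩
      ω m 0 * (h11 * h11 + h21 * h21) ^ m
        ≈⟨ *-cong refl (trans (^-congˡ m hᵀh-11) (1^n≈1 m)) ⟩
      ω m 0 * 1#
        ≈⟨ trans (*-identityʳ _) (reflexive (≡.sym (ψmono-even m 0))) ⟩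
      ψmono (double m) 0
        ≈⟨ ψ-mono (double m) 0 ⟨
      ψ (mono (double m) 0) ∎
      where open SO2 h

    ψ-act-odd : ∀ h n → ψ (act h (mono (suc (double n)) 1)) ≈ ψ (mono (suc (double n)) 1)
    ψ-act-odd h n = begin
      ψ (act h (mono (suc (double n)) 1))
        ≈⟨ trans (ψ≈lin (act h (mono (suc (double n)) 1))) (lin-act-mono h ψmono (suc (double n)) 1) ⟩
      lin ψmono (pow (linear h11 h21) (suc (double n)) ⊗ (linear h12 h22 ⊗ mono 0 0))
        ≈⟨ lin-⊗-congʳ (λ φ → lin-⊗-unitʳ φ (linear h12 h22)) ψmono (pow (linear h11 h21) (suc (double n))) ⟩
      lin ψmono (pow (linear h11 h21) (suc (double n)) ⊗ linear h12 h22)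
        ≈⟨ ψ-odd-power h11 h21 h12 h22 n ⟩
      ω (suc n) 0 * (h11 * h12 + h21 * h22) * (h11 * h11 + h21 * h21) ^ n
        ≈⟨ trans (*-cong (trans (*-cong refl hᵀh-12) (zeroʳ _)) refl) (zeroˡ _) ⟩
      0#
        ≈⟨ trans (ψ-mono (suc (double n)) 1) (reflexive (ψmono-oddˡ n 1)) ⟨
      ψ (mono (suc (double n)) 1) ∎
      where open SO2 h

open import Data.Nat using (_*_; _∸_; _≤_; s≤s; z≤n)

lemma10 : ∀ {c ℓ} (F : Field c ℓ) → FieldOps.CharZero F →
    (h : FieldOps.SO2 F) →
    ((m : ℕ) → Field._≈_ F (FieldOps.ψ F (FieldOps.act F h (FieldOps.mono F (2 * m) 0)))
                           (FieldOps.ψ F (FieldOps.mono F (2 * m) 0)))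
    × ((m : ℕ) → 1 ≤ m →
         Field._≈_ F (FieldOps.ψ F (FieldOps.act F h (FieldOps.mono F (2 * m ∸ 1) 1)))
                     (FieldOps.ψ F (FieldOps.mono F (2 * m ∸ 1) 1)))
lemma10 F char0 h = even , odd
  where
  open Field F using (_≈_)
  open FieldOps F using (ψ; act; mono)

  even : ∀ m → ψ (act h (mono (2 * m) 0)) ≈ ψ (mono (2 * m) 0)
  even m = ≡.subst (λ k → ψ (act h (mono k 0)) ≈ ψ (mono k 0)) (double≡2* m) (ψ-act-even F char0 h m)

  odd : ∀ m → 1 ≤ m → ψ (act h (mono (2 * m ∸ 1) 1)) ≈ ψ (mono (2 * m ∸ 1) 1)
  odd (suc n) (s≤s z≤n) =
    ≡.subst (λ k → ψ (act h (mono (k ∸ 1) 1)) ≈ ψ (mono (k ∸ 1) 1)) (double≡2* (suc n)) (ψ-act-odd F char0 h n)
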